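{- Let $1\le n<m$ and fix non-zero complex numbers $q_{kl}$, $1\le k<l\le m$, with $q_{kl}=q$ for all $k\le n<l$. Let $A=(a_{kl})_{m\times m}$ have non-commuting variable entries. For $n<i',j'\le m$ let $c_{i'j'}=a_{i'j'}+a_{i'*}(I-q^{ -1}A_0)^{ -1}(q^{ -1}a_{*j'})$ and $C=(c_{i'j'})_{n+1\le i',j'\le m}$. Fix $i,j\in\{n+1,\dots,m\}$. Then for all $i',j'\in\{n+1,\dots,m\}$, $$\big((I-A_{[ij]})^{ -1}\big)_{i'j'}=\big((I-C_{[ij]})^{ -1}\big)_{i'j'}.$$
   Context: Work in the $\mathbb C$-algebra of formal power series in non-commuting variables $a_{kl}$, $1\le k,l\le m$ (no relations imposed). $A_0=(a_{kl})_{1\le k,l\le n}$, $a_{k*}=(a_{k1},\dots,a_{kn})$, $a_{*l}=(a_{1l},\dots,a_{nl})^T$, $(I-X)^{ -1}=\sum_r X^r$. For a matrix $X=(x_{kl})$ indexed by a set of integers, $X_{[ij]}$ has entries $(X_{[ij]})_{kl}=\omega_j(l)\,\theta_i(k)\,x_{kl}$ where $\omega_j(l)=q_{jl}$ if $l>j$ and $1$ otherwise, and $\theta_i(k)=q_{ki}^{ -1}$ if $k<i$ and $1$ otherwise. $A_{[ij]}$ is indexed by $\{1,\dots,m\}$, $C_{[ij]}$ by $\{n+1,\dots,m\}$. -}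

module Defs where

open import Level using (_⊔_)
open import Algebra.Bundles using (CommutativeRing)
open import Data.Nat using (ℕ; zero; suc; _<ᵇ_; _≤ᵇ_)
open import Data.Fin using (Fin; toℕ)
open import Data.Fin.Properties using () renaming (_≟_ to _≟F_)
open import Data.Bool using (Bool; true; false; if_then_else_; _∧_)
open import Data.List using (List; []; _∷_; map; foldr; length; allFin; filterᵇ)
open import Data.Product using (_×_; _,_)
open import Relation.Nullary using (does)

splits : ∀ {a} {A : Set a} → List A → List (List A × List A)
splits []       = ([] , []) ∷ []
splits (x ∷ xs) = ([] , x ∷ xs) ∷ map (λ { (u , v) → (x ∷ u , v) }) (splits xs)

-- Formal power series over the commutative ring R in the non-commuting
-- variables a_{kl}, k,l ∈ Fin m  (0-based: Fin index k stands for k+1).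
module Series {c ℓ} (R : CommutativeRing c ℓ) (m : ℕ) where
  open CommutativeRing R

  Letter : Set
  Letter = Fin m × Fin m

  Word : Set
  Word = List Letter

  PS : Set c
  PS = Word → Carrier

  _≋_ : PS → PS → Set ℓ
  f ≋ g = ∀ w → f w ≈ g w

  sumL : List Carrier → Carrier
  sumL = foldr _+_ 0#

  0ps : PS
  0ps _ = 0#

  1ps : PS
  1ps []      = 1#
  1ps (_ ∷ _) = 0#

  _⊕_ : PS → PS → PS
  (f ⊕ g) w = f w + g w

  _·_ : Carrier → PS → PS
  (s · f) w = s * f w

  _⊛_ : PS → PS → PS
  (f ⊛ g) w = sumL (map (λ { (u , v) → f u * g v }) (splits w))

  eqLetter : Letter → Letter → Bool
  eqLetter (k , l) (k' , l') = does (k ≟F k') ∧ does (l ≟F l')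

  var : Fin m → Fin m → PS
  var k l []            = 0#
  var k l (x ∷ [])      = if eqLetter (k , l) x then 1# else 0#
  var k l (_ ∷ _ ∷ _)   = 0#

  -- matrices with series entries; the index set is given by a list I
  Mat : Set c
  Mat = Fin m → Fin m → PS

  sumPS : List PS → PS
  sumPS = foldr _⊕_ 0ps

  idM : Mat
  idM k l = if does (k ≟F l) then 1ps else 0ps

  mulM : List (Fin m) → Mat → Mat → Mat
  mulM I X Y k l = sumPS (map (λ p → X k p ⊛ Y p l) I)

  powM : List (Fin m) → Mat → ℕ → Mat
  powM I X zero    = idM
  powM I X (suc r) = mulM I (powM I X r) X

  -- (I - X)^{-1} = Σ_r X^r over the index set I.  For X whose entries have
  -- zero constant term (the only case used), X^r contributes nothing to the
  -- coefficient of a word w once r > length w, so the coefficient of w in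
  -- Σ_r X^r is the finite sum below.
  geomM : List (Fin m) → Mat → Mat
  geomM I X k l w = sumL (map (λ r → powM I X r k l w) (Data.List.upTo (suc (length w))))

  -- index sets (0-based): {1..m}, {1..n}, {n+1..m}
  fullIdx : List (Fin m)
  fullIdx = allFin m

  lowIdx : ℕ → List (Fin m)
  lowIdx n = filterᵇ (λ k → toℕ k <ᵇ n) (allFin m)

  highIdx : ℕ → List (Fin m)
  highIdx n = filterᵇ (λ k → n ≤ᵇ toℕ k) (allFin m)

  Avar : Mat
  Avar = var

  module Twist (q qinv : Fin m → Fin m → Carrier) where
    ω : Fin m → Fin m → Carrier
    ω j l = if toℕ j <ᵇ toℕ l then q j l else 1#
    θ : Fin m → Fin m → Carrier
    θ i k = if toℕ k <ᵇ toℕ i then qinv k i else 1#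
    twist : Fin m → Fin m → Mat → Mat
    twist i j X k l = (ω j l * θ i k) · X k l

  Cmat : ℕ → Carrier → Mat
  Cmat n qi i' j' =
    var i' j' ⊕
    sumPS (map (λ k → sumPS (map (λ l →
       var i' k ⊛ (geomM (lowIdx n) (λ x y → qi · var x y) k l ⊛ (qi · var l j')))
       (lowIdx n))) (lowIdx n))

-- Expanding (I − X)⁻¹ for X = A_{[ij]} gives a path series: the coefficient of a word
-- (k,b₁)(b₁,b₂)⋯(b_{r−1},l) is the product of the twist factors ω_j(b_t) θ_i(b_{t−1}) along
-- the path k → b₁ → ⋯ → l, and every other word has coefficient 0.  Cut a path between
-- indices > n at its visits to indices > n: each piece is either one direct step or an
-- excursion through indices ≤ n.  There ω_j = 1 and θ_i = q⁻¹, so the excursions from k to p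
-- add up to the twisted entry of a_{k*}(I − q⁻¹A₀)⁻¹ q⁻¹ a_{*p}.  Hence the path series solves
-- F = I + C_{[ij]} F on the indices > n, and since C has no constant term this equation
-- determines F word by word, so F = (I − C_{[ij]})⁻¹.

module Submission where

open import Defs
open import Algebra.Bundles using (CommutativeRing; CommutativeMonoid; Semiring)
open import Data.Nat using (ℕ; _≤_; _<_)
open import Data.Fin using (Fin; toℕ)

open import Data.Bool using (Bool; true; false; if_then_else_; _∧_; not; T)
open import Data.Bool.Properties using (if-∧; if-swap-then; if-float; if-eta; ∧-conicalʳ; T-≡)
import Data.Fin as Fin
open import Data.Fin.Properties using () renaming (_≟_ to _≟F_)
open import Data.List using (List; []; _∷_; map; foldr; length; allFin; filterᵇ; upTo)
open import Data.List.Properties using (map-upTo; map-tabulate; map-cong; map-∘)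
import Data.Nat as ℕ
open import Data.Nat using (zero; suc; z≤n; s≤s; _<ᵇ_; _≤ᵇ_)
import Data.Nat.Properties as ℕₚ
open import Data.Nat.Properties
  using (≤-refl; ≤-trans; <⇒≤; m≤n⇒m≤1+n; n<1+n; <-trans; <-≤-trans; <⇒<ᵇ; <ᵇ⇒<; ≤⇒≤ᵇ)
open import Data.Product using (_×_; _,_)
open import Data.Sum using (_⊎_; inj₁; inj₂)
open import Function using (id; Equivalence)
open import Relation.Nullary using (does; yes; no; contradiction)
open import Relation.Nullary.Decidable using (dec-true; dec-false)
open import Relation.Binary.PropositionalEquality using (_≡_; cong)
import Relation.Binary.PropositionalEquality as ≡
import Relation.Binary.Reasoning.Setoid as ≈-Reasoning

<ᵇ-suc : ∀ a b → (b <ᵇ suc a) ≡ (b ≤ᵇ a)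
<ᵇ-suc a zero    = ≡.refl
<ᵇ-suc a (suc b) = ≡.refl

<ᵇ≡not-≤ᵇ : ∀ a b → (a <ᵇ b) ≡ not (b ≤ᵇ a)
<ᵇ≡not-≤ᵇ a       zero    = ≡.refl
<ᵇ≡not-≤ᵇ zero    (suc b) = ≡.refl
<ᵇ≡not-≤ᵇ (suc a) (suc b) = ≡.trans (<ᵇ≡not-≤ᵇ a b) (cong not (≡.sym (<ᵇ-suc a b)))

≤⇒≤ᵇ≡true : ∀ {a b} → a ≤ b → (a ≤ᵇ b) ≡ true
≤⇒≤ᵇ≡true a≤b = Equivalence.to T-≡ (≤⇒≤ᵇ a≤b)

filterᵇ-accept-all : ∀ {a} {A : Set a} (xs : List A) → filterᵇ (λ _ → true) xs ≡ xs
filterᵇ-accept-all []       = ≡.refl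
filterᵇ-accept-all (x ∷ xs) = cong (x ∷_) (filterᵇ-accept-all xs)

does-≟-sym : ∀ {k} (a b : Fin k) → does (a ≟F b) ≡ does (b ≟F a)
does-≟-sym a b with a ≟F b
... | yes a≡b = ≡.sym (dec-true (b ≟F a) (≡.sym a≡b))
... | no  a≢b = ≡.sym (dec-false (b ≟F a) (λ b≡a → a≢b (≡.sym b≡a)))

module ListSum {c ℓ} (S : Semiring c ℓ) where
  open Semiring S hiding (zero)
  open ≈-Reasoning setoid
  open import Algebra.Properties.CommutativeSemigroup
    (CommutativeMonoid.commutativeSemigroup +-commutativeMonoid) using (interchange)

  when : Bool → Carrier → Carrier
  when b x = if b then x else 0#

  when-1-* : ∀ b x → when b 1# * x ≈ when b x
  when-1-* true  x = *-identityˡ x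
  when-1-* false x = zeroˡ x

  when-zero : ∀ b {x} → x ≈ 0# → when b x ≈ 0#
  when-zero true  x≈0 = x≈0
  when-zero false _   = refl

  when-true : ∀ {b} x → b ≡ true → when b x ≡ x
  when-true x ≡.refl = ≡.refl

  when-cong : ∀ b {x y} → (b ≡ true → x ≈ y) → when b x ≈ when b y
  when-cong true  x≈y = x≈y ≡.refl
  when-cong false _   = refl

  when-+ : ∀ b x y → when b x + when b y ≈ when b (x + y)
  when-+ true  x y = refl
  when-+ false x y = +-identityʳ 0#

  *-when : ∀ b a x → a * when b x ≈ when b (a * x)
  *-when true  a x = refl
  *-when false a x = zeroʳ a

  ∑ : ∀ {a} {A : Set a} → List A → (A → Carrier) → Carrier
  ∑ xs f = foldr _+_ 0# (map f xs)

  module _ {a} {A : Set a} where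

    ∑-cong : ∀ (xs : List A) {f g : A → Carrier} → (∀ x → f x ≈ g x) → ∑ xs f ≈ ∑ xs g
    ∑-cong []       f≈g = refl
    ∑-cong (x ∷ xs) f≈g = +-cong (f≈g x) (∑-cong xs f≈g)

    ∑-zero : ∀ (xs : List A) {f : A → Carrier} → (∀ x → f x ≈ 0#) → ∑ xs f ≈ 0#
    ∑-zero []       f≈0 = refl
    ∑-zero (x ∷ xs) f≈0 = trans (+-cong (f≈0 x) (∑-zero xs f≈0)) (+-identityˡ 0#)

    ∑-distrib-+ : ∀ (xs : List A) {f g : A → Carrier} →
                  ∑ xs (λ x → f x + g x) ≈ ∑ xs f + ∑ xs g
    ∑-distrib-+ []               = sym (+-identityˡ 0#)
    ∑-distrib-+ (x ∷ xs) {f} {g} =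
      trans (+-congˡ (∑-distrib-+ xs)) (interchange (f x) (g x) (∑ xs f) (∑ xs g))

    *-distribˡ-∑ : ∀ (xs : List A) {f : A → Carrier} a → a * ∑ xs f ≈ ∑ xs (λ x → a * f x)
    *-distribˡ-∑ []       a = zeroʳ a
    *-distribˡ-∑ (x ∷ xs) a = trans (distribˡ a _ _) (+-congˡ (*-distribˡ-∑ xs a))

    ∑-when : ∀ (xs : List A) b (f : A → Carrier) → ∑ xs (λ x → when b (f x)) ≈ when b (∑ xs f)
    ∑-when xs true  f = refl
    ∑-when xs false f = ∑-zero xs (λ _ → refl)

    ∑-filterᵇ : ∀ (xs : List A) (P : A → Bool) (f : A → Carrier) →
                ∑ (filterᵇ P xs) f ≈ ∑ xs (λ x → when (P x) (f x))
    ∑-filterᵇ []       P f = refl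
    ∑-filterᵇ (x ∷ xs) P f with P x
    ... | true  = +-congˡ (∑-filterᵇ xs P f)
    ... | false = trans (∑-filterᵇ xs P f) (sym (+-identityˡ _))

    ∑-filterᵇ-cong : ∀ (xs : List A) (P : A → Bool) {f g : A → Carrier} →
                     (∀ x → P x ≡ true → f x ≈ g x) → ∑ (filterᵇ P xs) f ≈ ∑ (filterᵇ P xs) g
    ∑-filterᵇ-cong []       P f≈g = refl
    ∑-filterᵇ-cong (x ∷ xs) P f≈g with P x in Px
    ... | true  = +-cong (f≈g x Px) (∑-filterᵇ-cong xs P f≈g)
    ... | false = ∑-filterᵇ-cong xs P f≈g

  ∑-comm : ∀ {a b} {A : Set a} {B : Set b} (xs : List A) (ys : List B) (f : A → B → Carrier) →
           ∑ xs (λ x → ∑ ys (f x)) ≈ ∑ ys (λ y → ∑ xs (λ x → f x y))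
  ∑-comm []       ys f = sym (∑-zero ys (λ _ → refl))
  ∑-comm (x ∷ xs) ys f = trans (+-congˡ (∑-comm xs ys f)) (sym (∑-distrib-+ ys))

  ∑-upTo-suc : ∀ n (g : ℕ → Carrier) → ∑ (upTo (suc n)) g ≡ g 0 + ∑ (upTo n) (λ r → g (suc r))
  ∑-upTo-suc n g = cong (foldr _+_ 0#)
    (≡.trans (map-upTo g (suc n)) (cong (g 0 ∷_) (≡.sym (map-upTo (λ r → g (suc r)) n))))

  ∑-upTo-truncate : ∀ n N (g : ℕ → Carrier) → n ≤ N → (∀ r → n ≤ r → g r ≈ 0#) →
                    ∑ (upTo N) g ≈ ∑ (upTo n) g
  ∑-upTo-truncate zero    N       g _         g≈0 = ∑-zero (upTo N) (λ r → g≈0 r z≤n)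
  ∑-upTo-truncate (suc n) (suc N) g (s≤s n≤N) g≈0 = begin
    ∑ (upTo (suc N)) g                       ≡⟨ ∑-upTo-suc N g ⟩
    g 0 + ∑ (upTo N) (λ r → g (suc r))
      ≈⟨ +-congˡ (∑-upTo-truncate n N _ n≤N (λ r n≤r → g≈0 (suc r) (s≤s n≤r))) ⟩
    g 0 + ∑ (upTo n) (λ r → g (suc r))       ≡⟨ ≡.sym (∑-upTo-suc n g) ⟩
    ∑ (upTo (suc n)) g                       ∎

  ∑-allFin-suc : ∀ k (h : Fin (suc k) → Carrier) →
                 ∑ (allFin (suc k)) h ≡ h Fin.zero + ∑ (allFin k) (λ p → h (Fin.suc p))
  ∑-allFin-suc k h = cong (λ hs → h Fin.zero + foldr _+_ 0# hs)
    (≡.trans (map-tabulate Fin.suc h) (≡.sym (map-tabulate id (λ p → h (Fin.suc p)))))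

  ∑-allFin-δ : ∀ {k} (g : Fin k → Carrier) (b : Fin k) →
               ∑ (allFin k) (λ p → when (does (p ≟F b)) (g p)) ≈ g b
  ∑-allFin-δ {suc k} g Fin.zero = begin
    _                              ≡⟨ ∑-allFin-suc k _ ⟩
    g Fin.zero + ∑ (allFin k) _    ≈⟨ +-congˡ (∑-zero (allFin k) (λ _ → refl)) ⟩
    g Fin.zero + 0#                ≈⟨ +-identityʳ _ ⟩
    g Fin.zero                     ∎
  ∑-allFin-δ {suc k} g (Fin.suc b) = begin
    _                              ≡⟨ ∑-allFin-suc k _ ⟩
    0# + ∑ (allFin k) _            ≈⟨ +-identityˡ _ ⟩
    ∑ (allFin k) _                 ≈⟨ ∑-allFin-δ (λ p → g (Fin.suc p)) b ⟩
    g (Fin.suc b)                  ∎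

  ∑-filterᵇ-δ : ∀ {k} (P : Fin k → Bool) (g : Fin k → Carrier) (b : Fin k) →
                ∑ (filterᵇ P (allFin k)) (λ p → when (does (p ≟F b)) (g p)) ≈ when (P b) (g b)
  ∑-filterᵇ-δ {k} P g b = begin
    ∑ (filterᵇ P (allFin k)) (λ p → when (does (p ≟F b)) (g p))
      ≈⟨ ∑-filterᵇ (allFin k) P _ ⟩
    ∑ (allFin k) (λ p → when (P p) (when (does (p ≟F b)) (g p)))
      ≡⟨ cong (foldr _+_ 0#) (map-cong (λ p → if-swap-then (P p) (does (p ≟F b)) {g p} {0#}) (allFin k)) ⟩
    ∑ (allFin k) (λ p → when (does (p ≟F b)) (when (P p) (g p)))
      ≈⟨ ∑-allFin-δ (λ p → when (P p) (g p)) b ⟩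
    when (P b) (g b) ∎

  ∑-filterᵇ-δ′ : ∀ {k} (P : Fin k → Bool) (g : Fin k → Carrier) (b : Fin k) →
                 ∑ (filterᵇ P (allFin k)) (λ p → when (does (b ≟F p)) (g p)) ≈ when (P b) (g b)
  ∑-filterᵇ-δ′ {k} P g b = trans
    (∑-cong (filterᵇ P (allFin k)) (λ p → reflexive (cong (λ d → when d (g p)) (does-≟-sym b p))))
    (∑-filterᵇ-δ P g b)

module SeriesAlgebra {c ℓ} (R : CommutativeRing c ℓ) (m : ℕ) where
  open CommutativeRing R hiding (zero)
  open Series R m
  open ListSum semiring public
  open ≈-Reasoning setoid
  open import Algebra.Properties.CommutativeSemigroup *-commutativeSemigroup using (x∙yz≈y∙xz)

  ∂ : Letter → PS → PS
  ∂ x f u = f (x ∷ u)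

  HasOrder : ℕ → PS → Set ℓ
  HasOrder r f = ∀ u → length u < r → f u ≈ 0#

  sumPS-apply : ∀ {a} {A : Set a} (xs : List A) (G : A → PS) w →
                sumPS (map G xs) w ≡ ∑ xs (λ x → G x w)
  sumPS-apply []       G w = ≡.refl
  sumPS-apply (x ∷ xs) G w = cong (G x w +_) (sumPS-apply xs G w)

  ⊛-[] : ∀ (f g : PS) → (f ⊛ g) [] ≈ f [] * g []
  ⊛-[] f g = +-identityʳ _

  ⊛-∷ : ∀ (f g : PS) x w → (f ⊛ g) (x ∷ w) ≈ f [] * g (x ∷ w) + (∂ x f ⊛ g) w
  ⊛-∷ f g x w = +-congˡ (reflexive (cong (foldr _+_ 0#) (≡.sym (map-∘ (splits w)))))

  ⊛-congˡ : ∀ {f f′ : PS} (g : PS) → f ≋ f′ → (f ⊛ g) ≋ (f′ ⊛ g)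
  ⊛-congˡ g f≋f′ w = ∑-cong (splits w) (λ { (u , v) → *-congʳ (f≋f′ u) })

  ⊛-congʳ-≤ : ∀ w (f : PS) {g g′ : PS} → (∀ v → length v ≤ length w → g v ≈ g′ v) →
              (f ⊛ g) w ≈ (f ⊛ g′) w
  ⊛-congʳ-≤ [] f {g} {g′} g≈g′ =
    trans (⊛-[] f g) (trans (*-congˡ (g≈g′ [] z≤n)) (sym (⊛-[] f g′)))
  ⊛-congʳ-≤ (x ∷ w) f {g} {g′} g≈g′ = begin
    (f ⊛ g) (x ∷ w)                     ≈⟨ ⊛-∷ f g x w ⟩
    f [] * g (x ∷ w) + (∂ x f ⊛ g) w    ≈⟨ +-cong (*-congˡ (g≈g′ (x ∷ w) ≤-refl))
                                             (⊛-congʳ-≤ w (∂ x f) (λ v v≤w → g≈g′ v (m≤n⇒m≤1+n v≤w))) ⟩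
    f [] * g′ (x ∷ w) + (∂ x f ⊛ g′) w  ≈⟨ sym (⊛-∷ f g′ x w) ⟩
    (f ⊛ g′) (x ∷ w)                    ∎

  f₀*≈0 : ∀ (f : PS) → f [] ≈ 0# → ∀ a → f [] * a ≈ 0#
  f₀*≈0 f f₀≈0 a = trans (*-congʳ f₀≈0) (zeroˡ a)

  ⊛-congʳ-< : ∀ w (f : PS) {g g′ : PS} → f [] ≈ 0# → (∀ v → length v < length w → g v ≈ g′ v) →
              (f ⊛ g) w ≈ (f ⊛ g′) w
  ⊛-congʳ-< []      f {g} {g′} f₀≈0 _     =
    trans (⊛-[] f g) (trans (f₀*≈0 f f₀≈0 _) (sym (trans (⊛-[] f g′) (f₀*≈0 f f₀≈0 _))))
  ⊛-congʳ-< (x ∷ w) f {g} {g′} f₀≈0 g≈g′ = begin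
    (f ⊛ g) (x ∷ w)                     ≈⟨ ⊛-∷ f g x w ⟩
    f [] * g (x ∷ w) + (∂ x f ⊛ g) w    ≈⟨ +-cong (trans (f₀*≈0 f f₀≈0 _) (sym (f₀*≈0 f f₀≈0 _)))
                                                  (⊛-congʳ-≤ w (∂ x f) (λ v v≤w → g≈g′ v (s≤s v≤w))) ⟩
    f [] * g′ (x ∷ w) + (∂ x f ⊛ g′) w  ≈⟨ sym (⊛-∷ f g′ x w) ⟩
    (f ⊛ g′) (x ∷ w)                    ∎

  ⊛-distribʳ-⊕ : ∀ (f g h : PS) → ((f ⊕ g) ⊛ h) ≋ ((f ⊛ h) ⊕ (g ⊛ h))
  ⊛-distribʳ-⊕ f g h w =
    trans (∑-cong (splits w) (λ { (u , v) → distribʳ (h v) (f u) (g u) })) (∑-distrib-+ (splits w))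

  ·-⊛ : ∀ a (f h : PS) → ((a · f) ⊛ h) ≋ (a · (f ⊛ h))
  ·-⊛ a f h w =
    trans (∑-cong (splits w) (λ { (u , v) → *-assoc a (f u) (h v) })) (sym (*-distribˡ-∑ (splits w) a))

  ⊛-zeroˡ : ∀ {f : PS} (h : PS) → f ≋ 0ps → (f ⊛ h) ≋ 0ps
  ⊛-zeroˡ h f≋0 w = ∑-zero (splits w) (λ { (u , v) → trans (*-congʳ (f≋0 u)) (zeroˡ _) })

  ⊛-zeroʳ : ∀ (f : PS) {h : PS} → h ≋ 0ps → (f ⊛ h) ≋ 0ps
  ⊛-zeroʳ f h≋0 w = ∑-zero (splits w) (λ { (u , v) → trans (*-congˡ (h≋0 v)) (zeroʳ _) })

  sumPS-⊛ : ∀ {a} {A : Set a} (xs : List A) (G : A → PS) (h : PS) w →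
            (sumPS (map G xs) ⊛ h) w ≈ ∑ xs (λ x → (G x ⊛ h) w)
  sumPS-⊛ []       G h w = ⊛-zeroˡ h (λ _ → refl) w
  sumPS-⊛ (x ∷ xs) G h w = trans (⊛-distribʳ-⊕ (G x) _ h w) (+-congˡ (sumPS-⊛ xs G h w))

  ⊛-∑ʳ : ∀ {a} {A : Set a} (xs : List A) (f : PS) (G : A → PS) w →
         (f ⊛ (λ v → ∑ xs (λ x → G x v))) w ≈ ∑ xs (λ x → (f ⊛ G x) w)
  ⊛-∑ʳ []       f G w = ⊛-zeroʳ f (λ _ → refl) w
  ⊛-∑ʳ (x ∷ xs) f G w = trans
    (∑-cong (splits w) (λ { (u , v) → distribˡ (f u) (G x v) _ }))
    (trans (∑-distrib-+ (splits w)) (+-congˡ (⊛-∑ʳ xs f G w)))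

  1ps-⊛ : ∀ (f : PS) → (1ps ⊛ f) ≋ f
  1ps-⊛ f []      = trans (⊛-[] 1ps f) (*-identityˡ _)
  1ps-⊛ f (x ∷ w) = trans (⊛-∷ 1ps f x w)
    (trans (+-cong (*-identityˡ _) (⊛-zeroˡ f (λ _ → refl) w)) (+-identityʳ _))

  ⊛-1ps : ∀ (f : PS) → (f ⊛ 1ps) ≋ f
  ⊛-1ps f []      = trans (⊛-[] f 1ps) (*-identityʳ _)
  ⊛-1ps f (x ∷ w) = trans (⊛-∷ f 1ps x w)
    (trans (+-cong (zeroʳ _) (⊛-1ps (∂ x f) w)) (+-identityˡ _))

  ∂-⊛ : ∀ (f g : PS) x → ∂ x (f ⊛ g) ≋ ((f [] · ∂ x g) ⊕ (∂ x f ⊛ g))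
  ∂-⊛ f g x = ⊛-∷ f g x

  ⊛-assoc : ∀ (f g h : PS) → ((f ⊛ g) ⊛ h) ≋ (f ⊛ (g ⊛ h))
  ⊛-assoc f g h [] = begin
    ((f ⊛ g) ⊛ h) []         ≈⟨ trans (⊛-[] (f ⊛ g) h) (*-congʳ (⊛-[] f g)) ⟩
    (f [] * g []) * h []     ≈⟨ *-assoc _ _ _ ⟩
    f [] * (g [] * h [])     ≈⟨ sym (trans (⊛-[] f (g ⊛ h)) (*-congˡ (⊛-[] g h))) ⟩
    (f ⊛ (g ⊛ h)) []         ∎
  ⊛-assoc f g h (x ∷ w) = begin
    ((f ⊛ g) ⊛ h) (x ∷ w)
      ≈⟨ ⊛-∷ (f ⊛ g) h x w ⟩
    (f ⊛ g) [] * h (x ∷ w) + (∂ x (f ⊛ g) ⊛ h) w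
      ≈⟨ +-cong (*-congʳ (⊛-[] f g)) (⊛-congˡ h (∂-⊛ f g x) w) ⟩
    (f [] * g []) * h (x ∷ w) + (((f [] · ∂ x g) ⊕ (∂ x f ⊛ g)) ⊛ h) w
      ≈⟨ +-congˡ (trans (⊛-distribʳ-⊕ _ _ h w) (+-cong (·-⊛ (f []) (∂ x g) h w) (⊛-assoc (∂ x f) g h w))) ⟩
    (f [] * g []) * h (x ∷ w) + (f [] * (∂ x g ⊛ h) w + (∂ x f ⊛ (g ⊛ h)) w)
      ≈⟨ sym (+-assoc _ _ _) ⟩
    ((f [] * g []) * h (x ∷ w) + f [] * (∂ x g ⊛ h) w) + (∂ x f ⊛ (g ⊛ h)) w
      ≈⟨ +-congʳ (trans (+-congʳ (*-assoc _ _ _)) (sym (distribˡ (f []) _ _))) ⟩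
    f [] * (g [] * h (x ∷ w) + (∂ x g ⊛ h) w) + (∂ x f ⊛ (g ⊛ h)) w
      ≈⟨ +-congʳ (*-congˡ (sym (⊛-∷ g h x w))) ⟩
    f [] * (g ⊛ h) (x ∷ w) + (∂ x f ⊛ (g ⊛ h)) w
      ≈⟨ sym (⊛-∷ f (g ⊛ h) x w) ⟩
    (f ⊛ (g ⊛ h)) (x ∷ w) ∎

  ⊛-order : ∀ a b {f g : PS} → HasOrder a f → HasOrder b g → HasOrder (a ℕ.+ b) (f ⊛ g)
  ⊛-order zero    b {f} {g} _  g₀ []      lt       =
    trans (⊛-[] f g) (trans (*-congˡ (g₀ [] lt)) (zeroʳ _))
  ⊛-order (suc a) b {f} {g} f₀ _  []      _        =
    trans (⊛-[] f g) (trans (*-congʳ (f₀ [] (s≤s z≤n))) (zeroˡ _))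
  ⊛-order zero    b {f} {g} _  g₀ (x ∷ w) lt       = trans (⊛-∷ f g x w)
    (trans (+-cong (trans (*-congˡ (g₀ (x ∷ w) lt)) (zeroʳ _))
                   (⊛-order zero b {∂ x f} (λ _ ()) g₀ w (<-trans (n<1+n _) lt)))
           (+-identityˡ 0#))
  ⊛-order (suc a) b {f} {g} f₀ g₀ (x ∷ w) (s≤s lt) = trans (⊛-∷ f g x w)
    (trans (+-cong (trans (*-congʳ (f₀ [] (s≤s z≤n))) (zeroˡ _))
                   (⊛-order a b {∂ x f} (λ u u<a → f₀ (x ∷ u) (s≤s u<a)) g₀ w lt))
           (+-identityˡ 0#))

  const-⊛ : ∀ (g F : PS) → (∀ x u → g (x ∷ u) ≈ 0#) → ∀ w → (g ⊛ F) w ≈ g [] * F w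
  const-⊛ g F g₊≈0 []      = ⊛-[] g F
  const-⊛ g F g₊≈0 (x ∷ w) = trans (⊛-∷ g F x w)
    (trans (+-congˡ (⊛-zeroˡ F (g₊≈0 x) w)) (+-identityʳ _))

  var-⊛-[] : ∀ k r (F : PS) → (var k r ⊛ F) [] ≈ 0#
  var-⊛-[] k r F = trans (⊛-[] (var k r) F) (zeroˡ _)

  var-⊛-∷ : ∀ k r (F : PS) x w → (var k r ⊛ F) (x ∷ w) ≈ when (eqLetter (k , r) x) (F w)
  var-⊛-∷ k r F x w = begin
    (var k r ⊛ F) (x ∷ w)                        ≈⟨ ⊛-∷ (var k r) F x w ⟩
    0# * F (x ∷ w) + (∂ x (var k r) ⊛ F) w
      ≈⟨ +-cong (zeroˡ _) (const-⊛ (∂ x (var k r)) F (λ _ _ → refl) w) ⟩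
    0# + when (eqLetter (k , r) x) 1# * F w      ≈⟨ +-identityˡ _ ⟩
    when (eqLetter (k , r) x) 1# * F w           ≈⟨ when-1-* (eqLetter (k , r) x) (F w) ⟩
    when (eqLetter (k , r) x) (F w)              ∎

  when·-⊛ : ∀ b a (F G : PS) w → ((λ u → when b (a * F u)) ⊛ G) w ≈ when b (a * (F ⊛ G) w)
  when·-⊛ true  a F G w = ·-⊛ a F G w
  when·-⊛ false a F G w = ⊛-zeroˡ G (λ _ → refl) w

  ⊛-congʳ : ∀ (f : PS) {g g′ : PS} → g ≋ g′ → (f ⊛ g) ≋ (f ⊛ g′)
  ⊛-congʳ f g≋g′ w = ∑-cong (splits w) (λ { (u , v) → *-congˡ (g≋g′ v) })

  ⊛-sumPS : ∀ {a} {A : Set a} (xs : List A) (f : PS) (G : A → PS) w →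
            (f ⊛ sumPS (map G xs)) w ≈ ∑ xs (λ x → (f ⊛ G x) w)
  ⊛-sumPS xs f G w = trans (⊛-congʳ f (λ v → reflexive (sumPS-apply xs G v)) w) (⊛-∑ʳ xs f G w)

  idM-[] : ∀ k l → idM k l [] ≡ when (does (k ≟F l)) 1#
  idM-[] k l = if-float (λ (f : PS) → f []) (does (k ≟F l)) {1ps} {0ps}

  idM-∷ : ∀ k l x w → idM k l (x ∷ w) ≈ 0#
  idM-∷ k l x w = reflexive
    (≡.trans (if-float (λ (f : PS) → f (x ∷ w)) (does (k ≟F l)) {1ps} {0ps}) (if-eta (does (k ≟F l))))

  idM-⊛ : ∀ k p (G : PS) w → (idM k p ⊛ G) w ≈ when (does (k ≟F p)) (G w)
  idM-⊛ k p G w with does (k ≟F p)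
  ... | true  = 1ps-⊛ G w
  ... | false = ⊛-zeroˡ G (λ _ → refl) w

  ⊛-idM : ∀ p l (G : PS) w → (G ⊛ idM p l) w ≈ when (does (p ≟F l)) (G w)
  ⊛-idM p l G w with does (p ≟F l)
  ... | true  = ⊛-1ps G w
  ... | false = ⊛-zeroʳ G (λ _ → refl) w

  module Geometric (P : Fin m → Bool) (Y : Mat) (Y₀ : ∀ k l → Y k l [] ≈ 0#) where
    I : List (Fin m)
    I = filterᵇ P (allFin m)

    SolvesGeom : Mat → Set ℓ
    SolvesGeom F = ∀ k l → P k ≡ true → P l ≡ true → ∀ w →
                   F k l w ≈ idM k l w + ∑ I (λ p → (Y k p ⊛ F p l) w)

    powM-order : ∀ r k l → HasOrder r (powM I Y r k l)
    powM-order (suc r) k l w w<1+r = trans (reflexive (sumPS-apply I (λ p → powM I Y r k p ⊛ Y p l) w))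
      (∑-zero I (λ p → ⊛-order r 1 (powM-order r k p) Y-order w
        (≡.subst (length w <_) (ℕₚ.+-comm 1 r) w<1+r)))
      where
      Y-order : ∀ {p} → HasOrder 1 (Y p l)
      Y-order {p} []      _           = Y₀ p l
      Y-order     (_ ∷ _) (s≤s ())

    powM-suc-left : ∀ r k l → P k ≡ true → P l ≡ true → ∀ w →
                    powM I Y (suc r) k l w ≈ ∑ I (λ p → (Y k p ⊛ powM I Y r p l) w)
    powM-suc-left zero k l Pk Pl w = begin
      powM I Y 1 k l w                                    ≡⟨ sumPS-apply I (λ p → idM k p ⊛ Y p l) w ⟩
      ∑ I (λ p → (idM k p ⊛ Y p l) w)                     ≈⟨ ∑-cong I (λ p → idM-⊛ k p (Y p l) w) ⟩
      ∑ I (λ p → when (does (k ≟F p)) (Y p l w))          ≈⟨ ∑-filterᵇ-δ′ P (λ p → Y p l w) k ⟩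
      when (P k) (Y k l w)                                ≡⟨ cong (λ b → when b (Y k l w)) (≡.trans Pk (≡.sym Pl)) ⟩
      when (P l) (Y k l w)                                ≈⟨ sym (∑-filterᵇ-δ P (λ p → Y k p w) l) ⟩
      ∑ I (λ p → when (does (p ≟F l)) (Y k p w))          ≈⟨ sym (∑-cong I (λ p → ⊛-idM p l (Y k p) w)) ⟩
      ∑ I (λ p → (Y k p ⊛ idM p l) w)                     ∎
    powM-suc-left (suc r) k l Pk Pl w = begin
      powM I Y (suc (suc r)) k l w
        ≡⟨ sumPS-apply I (λ p → powM I Y (suc r) k p ⊛ Y p l) w ⟩
      ∑ I (λ p → (powM I Y (suc r) k p ⊛ Y p l) w)
        ≈⟨ ∑-filterᵇ-cong (allFin m) P (λ p Pp → ⊛-congˡ (Y p l) (λ u → trans (powM-suc-left r k p Pk Pp u)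
             (reflexive (≡.sym (sumPS-apply I (λ p′ → Y k p′ ⊛ powM I Y r p′ p) u)))) w) ⟩
      ∑ I (λ p → (sumPS (map (λ p′ → Y k p′ ⊛ powM I Y r p′ p) I) ⊛ Y p l) w)
        ≈⟨ ∑-cong I (λ p → sumPS-⊛ I (λ p′ → Y k p′ ⊛ powM I Y r p′ p) (Y p l) w) ⟩
      ∑ I (λ p → ∑ I (λ p′ → ((Y k p′ ⊛ powM I Y r p′ p) ⊛ Y p l) w))
        ≈⟨ ∑-cong I (λ p → ∑-cong I (λ p′ → ⊛-assoc (Y k p′) (powM I Y r p′ p) (Y p l) w)) ⟩
      ∑ I (λ p → ∑ I (λ p′ → (Y k p′ ⊛ (powM I Y r p′ p ⊛ Y p l)) w))
        ≈⟨ ∑-comm I I _ ⟩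
      ∑ I (λ p′ → ∑ I (λ p → (Y k p′ ⊛ (powM I Y r p′ p ⊛ Y p l)) w))
        ≈⟨ ∑-cong I (λ p′ → sym (⊛-sumPS I (Y k p′) (λ p → powM I Y r p′ p ⊛ Y p l) w)) ⟩
      ∑ I (λ p′ → (Y k p′ ⊛ powM I Y (suc r) p′ l) w) ∎

    geomM-truncate : ∀ N k l v → length v < N → ∑ (upTo N) (λ r → powM I Y r k l v) ≈ geomM I Y k l v
    geomM-truncate N k l v v<N =
      ∑-upTo-truncate (suc (length v)) N _ v<N (λ r v<r → powM-order r k l v v<r)

    geomM-solves : SolvesGeom (geomM I Y)
    geomM-solves k l Pk Pl w = begin
      geomM I Y k l w
        ≡⟨ ∑-upTo-suc (length w) (λ r → powM I Y r k l w) ⟩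
      idM k l w + ∑ (upTo (length w)) (λ r → powM I Y (suc r) k l w)
        ≈⟨ +-congˡ (∑-cong (upTo (length w)) (λ r → powM-suc-left r k l Pk Pl w)) ⟩
      idM k l w + ∑ (upTo (length w)) (λ r → ∑ I (λ p → (Y k p ⊛ powM I Y r p l) w))
        ≈⟨ +-congˡ (∑-comm (upTo (length w)) I _) ⟩
      idM k l w + ∑ I (λ p → ∑ (upTo (length w)) (λ r → (Y k p ⊛ powM I Y r p l) w))
        ≈⟨ +-congˡ (∑-cong I (λ p → sym (⊛-∑ʳ (upTo (length w)) (Y k p) (λ r → powM I Y r p l) w))) ⟩
      idM k l w + ∑ I (λ p → (Y k p ⊛ (λ v → ∑ (upTo (length w)) (λ r → powM I Y r p l v))) w)
        ≈⟨ +-congˡ (∑-cong I (λ p → ⊛-congʳ-< w (Y k p) (Y₀ k p)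
             (λ v v<w → geomM-truncate (length w) p l v v<w))) ⟩
      idM k l w + ∑ I (λ p → (Y k p ⊛ geomM I Y p l) w) ∎

    geomM-unique : ∀ F → SolvesGeom F → ∀ k l → P k ≡ true → P l ≡ true → geomM I Y k l ≋ F k l
    geomM-unique F F-solves k l Pk Pl w = agree (suc (length w)) w ≤-refl k l Pk Pl
      where
      agree : ∀ N w → length w < N → ∀ k l → P k ≡ true → P l ≡ true → geomM I Y k l w ≈ F k l w
      agree (suc N) w (s≤s w≤N) k l Pk Pl = begin
        geomM I Y k l w                                   ≈⟨ geomM-solves k l Pk Pl w ⟩
        idM k l w + ∑ I (λ p → (Y k p ⊛ geomM I Y p l) w)
          ≈⟨ +-congˡ (∑-filterᵇ-cong (allFin m) P (λ p Pp → ⊛-congʳ-< w (Y k p) (Y₀ k p)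
               (λ v v<w → agree N v (<-≤-trans v<w w≤N) p l Pp Pl))) ⟩
        idM k l w + ∑ I (λ p → (Y k p ⊛ F p l) w)         ≈⟨ sym (F-solves k l Pk Pl w) ⟩
        F k l w                                           ∎

  pathSeries : (Fin m → Bool) → (Fin m → Fin m → Carrier) → Fin m → Fin m → PS
  pathSeries P wt k l []            = when (does (k ≟F l)) 1#
  pathSeries P wt k l ((a , b) ∷ w) = when (does (k ≟F a) ∧ P b) (wt k b * pathSeries P wt b l w)

  module WeightedLetters (P : Fin m → Bool) (wt : Fin m → Fin m → Carrier) where
    X : Mat
    X k l = wt k l · var k l

    open Geometric P X (λ k l → zeroʳ _) using (I; powM-order)

    X-∷ : ∀ k l a b w → P l ≡ true → X k l ((a , b) ∷ w) ≈ when (does (k ≟F a) ∧ P b) (wt k b * idM b l w)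
    X-∷ k l a b (_ ∷ _) _  = trans (zeroʳ _) (sym (when-zero _ (trans (*-congˡ (idM-∷ b l _ _)) (zeroʳ _))))
    X-∷ k l a b []      Pl with k ≟F a | l ≟F b
    ... | no _       | _          = zeroʳ _
    ... | yes ≡.refl | yes ≡.refl rewrite Pl | dec-true (l ≟F l) ≡.refl = refl
    ... | yes ≡.refl | no l≢b     rewrite dec-false (b ≟F l) (λ b≡l → l≢b (≡.sym b≡l)) =
      trans (zeroʳ _) (sym (when-zero (P b) (zeroʳ _)))

    powM-∷ : ∀ r k l → P k ≡ true → P l ≡ true → ∀ a b w →
             powM I X (suc r) k l ((a , b) ∷ w) ≈ when (does (k ≟F a) ∧ P b) (wt k b * powM I X r b l w)
    powM-∷ zero k l Pk Pl a b w = begin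
      powM I X 1 k l ((a , b) ∷ w)                             ≡⟨ sumPS-apply I (λ p → idM k p ⊛ X p l) _ ⟩
      ∑ I (λ p → (idM k p ⊛ X p l) ((a , b) ∷ w))              ≈⟨ ∑-cong I (λ p → idM-⊛ k p (X p l) ((a , b) ∷ w)) ⟩
      ∑ I (λ p → when (does (k ≟F p)) (X p l ((a , b) ∷ w)))   ≈⟨ ∑-filterᵇ-δ′ P (λ p → X p l ((a , b) ∷ w)) k ⟩
      when (P k) (X k l ((a , b) ∷ w))                         ≡⟨ when-true _ Pk ⟩
      X k l ((a , b) ∷ w)                                      ≈⟨ X-∷ k l a b w Pl ⟩
      when (does (k ≟F a) ∧ P b) (wt k b * idM b l w)          ∎
    powM-∷ (suc r) k l Pk Pl a b w = begin
      powM I X (suc (suc r)) k l ((a , b) ∷ w)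
        ≡⟨ sumPS-apply I (λ p → powM I X (suc r) k p ⊛ X p l) _ ⟩
      ∑ I (λ p → (powM I X (suc r) k p ⊛ X p l) ((a , b) ∷ w))
        ≈⟨ ∑-filterᵇ-cong (allFin m) P (λ p Pp → step p Pp) ⟩
      ∑ I (λ p → when B (wt k b * (powM I X r b p ⊛ X p l) w))
        ≈⟨ ∑-when I B _ ⟩
      when B (∑ I (λ p → wt k b * (powM I X r b p ⊛ X p l) w))
        ≈⟨ when-cong B (λ _ → sym (*-distribˡ-∑ I (wt k b))) ⟩
      when B (wt k b * ∑ I (λ p → (powM I X r b p ⊛ X p l) w))
        ≡⟨ cong (λ s → when B (wt k b * s)) (≡.sym (sumPS-apply I (λ p → powM I X r b p ⊛ X p l) w)) ⟩
      when B (wt k b * powM I X (suc r) b l w) ∎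
      where
      B = does (k ≟F a) ∧ P b
      step : ∀ p → P p ≡ true →
             (powM I X (suc r) k p ⊛ X p l) ((a , b) ∷ w) ≈ when B (wt k b * (powM I X r b p ⊛ X p l) w)
      step p Pp = begin
        (powM I X (suc r) k p ⊛ X p l) ((a , b) ∷ w)
          ≈⟨ ⊛-∷ _ (X p l) (a , b) w ⟩
        powM I X (suc r) k p [] * X p l ((a , b) ∷ w) + (∂ (a , b) (powM I X (suc r) k p) ⊛ X p l) w
          ≈⟨ +-cong (trans (*-congʳ (powM-order (suc r) k p [] (s≤s z≤n))) (zeroˡ _))
                    (⊛-congˡ (X p l) (λ u → powM-∷ r k p Pk Pp a b u) w) ⟩
        0# + ((λ u → when B (wt k b * powM I X r b p u)) ⊛ X p l) w
          ≈⟨ trans (+-identityˡ _) (when·-⊛ B (wt k b) (powM I X r b p) (X p l) w) ⟩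
        when B (wt k b * (powM I X r b p ⊛ X p l) w) ∎

    geomM≈pathSeries : ∀ k l → P k ≡ true → P l ≡ true → geomM I X k l ≋ pathSeries P wt k l
    geomM≈pathSeries k l Pk Pl []            = trans (+-identityʳ (idM k l [])) (reflexive (idM-[] k l))
    geomM≈pathSeries k l Pk Pl ((a , b) ∷ w) = begin
      geomM I X k l ((a , b) ∷ w)
        ≡⟨ ∑-upTo-suc (suc (length w)) _ ⟩
      idM k l ((a , b) ∷ w) + ∑ (upTo (suc (length w))) (λ r → powM I X (suc r) k l ((a , b) ∷ w))
        ≈⟨ +-cong (idM-∷ k l _ w) (∑-cong (upTo (suc (length w))) (λ r → powM-∷ r k l Pk Pl a b w)) ⟩
      0# + ∑ (upTo (suc (length w))) (λ r → when B (wt k b * powM I X r b l w))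
        ≈⟨ trans (+-identityˡ _) (∑-when (upTo (suc (length w))) B _) ⟩
      when B (∑ (upTo (suc (length w))) (λ r → wt k b * powM I X r b l w))
        ≈⟨ when-cong B (λ B≡true → trans (sym (*-distribˡ-∑ (upTo (suc (length w))) (wt k b)))
             (*-congˡ (geomM≈pathSeries b l (∧-conicalʳ _ _ B≡true) Pl w))) ⟩
      when B (wt k b * pathSeries P wt b l w) ∎
      where
      B = does (k ≟F a) ∧ P b

  *-*-when-∧ : ∀ d e a b x → a * (b * when (d ∧ e) x) ≈ when d (b * when e (a * x))
  *-*-when-∧ true  true  a b x = x∙yz≈y∙xz a b x
  *-*-when-∧ true  false a b x = trans (*-congˡ (zeroʳ b)) (trans (zeroʳ a) (sym (zeroʳ b)))
  *-*-when-∧ false e     a b x = trans (*-congˡ (zeroʳ b)) (zeroʳ a)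

  *-inverse-unique : ∀ {x y x′ y′} → x ≈ y → x * x′ ≈ 1# → y * y′ ≈ 1# → x′ ≈ y′
  *-inverse-unique {x} {y} {x′} {y′} x≈y xx′≈1 yy′≈1 = begin
    x′             ≈⟨ sym (*-identityʳ x′) ⟩
    x′ * 1#        ≈⟨ *-congˡ (sym yy′≈1) ⟩
    x′ * (y * y′)  ≈⟨ sym (*-assoc _ _ _) ⟩
    (x′ * y) * y′  ≈⟨ *-congʳ (trans (*-comm x′ y) (*-congʳ (sym x≈y))) ⟩
    (x * x′) * y′  ≈⟨ *-congʳ xx′≈1 ⟩
    1# * y′        ≈⟨ *-identityˡ y′ ⟩
    y′             ∎

  module _ (q qinv : Fin m → Fin m → Carrier) where
    open Twist q qinv using (ω; θ)

    ω-below : ∀ {n} j → n ≤ toℕ j → ∀ b → toℕ b < n → ω j b ≈ 1#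
    ω-below j n≤j b b<n = reflexive (cong (λ c → if c then q j b else 1#) j≮b)
      where
      j≮b : (toℕ j <ᵇ toℕ b) ≡ false
      j≮b = ≡.trans (<ᵇ≡not-≤ᵇ (toℕ j) (toℕ b)) (cong not (≤⇒≤ᵇ≡true (≤-trans (<⇒≤ b<n) n≤j)))

    θ-below : ∀ {n} (qq q⁻¹ : Carrier) →
              (∀ k l → toℕ k < toℕ l → q k l * qinv k l ≈ 1#) → qq * q⁻¹ ≈ 1# →
              (∀ k l → toℕ k < n → n ≤ toℕ l → q k l ≈ qq) →
              ∀ i → n ≤ toℕ i → ∀ b → toℕ b < n → θ i b ≈ q⁻¹
    θ-below qq q⁻¹ q-inv qq-inv q-cross i n≤i b b<n = begin
      θ i b     ≡⟨ cong (λ c → if c then qinv b i else 1#) (Equivalence.to T-≡ (<⇒<ᵇ b<i)) ⟩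
      qinv b i  ≈⟨ *-inverse-unique (q-cross b i b<n n≤i) (q-inv b i b<i) qq-inv ⟩
      q⁻¹       ∎
      where b<i = <-≤-trans b<n n≤i

  module SchurComplement (n : ℕ) (q qinv : Fin m → Fin m → Carrier) (q⁻¹ : Carrier) (i j : Fin m)
    (ω-low : ∀ b → toℕ b < n → Twist.ω q qinv j b ≈ 1#)
    (θ-low : ∀ b → toℕ b < n → Twist.θ q qinv i b ≈ q⁻¹) where
    open Twist q qinv using (ω; θ; twist)

    high low : Fin m → Bool
    high k = n ≤ᵇ toℕ k
    low  k = toℕ k <ᵇ n

    Ih Il : List (Fin m)
    Ih = highIdx n
    Il = lowIdx n

    high-or-low : ∀ b → (high b ≡ true × low b ≡ false) ⊎ (high b ≡ false × low b ≡ true)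
    high-or-low b rewrite <ᵇ≡not-≤ᵇ (toℕ b) n with high b
    ... | true  = inj₁ (≡.refl , ≡.refl)
    ... | false = inj₂ (≡.refl , ≡.refl)

    low⇒≢high : ∀ b l → low b ≡ true → high l ≡ true → does (b ≟F l) ≡ false
    low⇒≢high b l low-b high-l = dec-false (b ≟F l) λ { ≡.refl →
      contradiction (≡.trans (≡.sym low-b) (≡.trans (<ᵇ≡not-≤ᵇ (toℕ b) n) (cong not high-l))) (λ ()) }

    low⇒< : ∀ b → low b ≡ true → toℕ b < n
    low⇒< b low-b = <ᵇ⇒< (toℕ b) n (≡.subst T (≡.sym low-b) _)

    ω≈1 : ∀ b → low b ≡ true → ω j b ≈ 1#
    ω≈1 b low-b = ω-low b (low⇒< b low-b)

    θ≈q⁻¹ : ∀ b → low b ≡ true → θ i b ≈ q⁻¹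
    θ≈q⁻¹ b low-b = θ-low b (low⇒< b low-b)

    wt : Fin m → Fin m → Carrier
    wt k l = ω j l * θ i k

    Path LowPath : Fin m → Fin m → PS
    Path    = pathSeries (λ _ → true) wt
    LowPath = pathSeries low (λ _ _ → q⁻¹)

    crossing : Fin m → Fin m → Fin m → PS
    crossing s p l = (q⁻¹ · var s p) ⊛ Path p l

    -- A path from a low index to a high one, cut at its first step s → p into a high index.
    viaFirstExit : Fin m → Fin m → PS
    viaFirstExit b l w = ∑ Ih (λ p → ω j p * ∑ Il (λ s → (LowPath b s ⊛ crossing s p l) w))

    crossing-[] : ∀ s p l → crossing s p l [] ≈ 0#
    crossing-[] s p l = trans (·-⊛ q⁻¹ (var s p) (Path p l) []) (trans (*-congˡ (var-⊛-[] s p (Path p l))) (zeroʳ _))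

    crossing-∷ : ∀ s p l x w → crossing s p l (x ∷ w) ≈ q⁻¹ * when (eqLetter (s , p) x) (Path p l w)
    crossing-∷ s p l x w = trans (·-⊛ q⁻¹ (var s p) (Path p l) (x ∷ w)) (*-congˡ (var-⊛-∷ s p (Path p l) x w))

    excursion-∷ : ∀ b l s p a b′ w →
      (LowPath b s ⊛ crossing s p l) ((a , b′) ∷ w) ≈
        when (does (b ≟F s)) (q⁻¹ * when (does (s ≟F a) ∧ does (p ≟F b′)) (Path p l w))
        + when (does (b ≟F a) ∧ low b′) (q⁻¹ * (LowPath b′ s ⊛ crossing s p l) w)
    excursion-∷ b l s p a b′ w = trans (⊛-∷ (LowPath b s) (crossing s p l) (a , b′) w)
      (+-cong (trans (*-congˡ (crossing-∷ s p l (a , b′) w)) (when-1-* (does (b ≟F s)) _))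
              (when·-⊛ (does (b ≟F a) ∧ low b′) q⁻¹ (LowPath b′ s) (crossing s p l) w))

    ∑-excursion-∷ : ∀ b l p a b′ w → low b ≡ true →
      ∑ Il (λ s → (LowPath b s ⊛ crossing s p l) ((a , b′) ∷ w)) ≈
        q⁻¹ * when (does (b ≟F a) ∧ does (p ≟F b′)) (Path p l w)
        + when (does (b ≟F a) ∧ low b′) (q⁻¹ * ∑ Il (λ s → (LowPath b′ s ⊛ crossing s p l) w))
    ∑-excursion-∷ b l p a b′ w low-b = begin
      ∑ Il (λ s → (LowPath b s ⊛ crossing s p l) ((a , b′) ∷ w))
        ≈⟨ trans (∑-cong Il (λ s → excursion-∷ b l s p a b′ w)) (∑-distrib-+ Il) ⟩
      ∑ Il (λ s → when (does (b ≟F s)) (q⁻¹ * when (does (s ≟F a) ∧ does (p ≟F b′)) (Path p l w)))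
        + ∑ Il (λ s → when G (q⁻¹ * (LowPath b′ s ⊛ crossing s p l) w))
        ≈⟨ +-cong (trans (∑-filterᵇ-δ′ low _ b) (reflexive (when-true _ low-b)))
                  (trans (∑-when Il G _) (when-cong G (λ _ → sym (*-distribˡ-∑ Il q⁻¹)))) ⟩
      q⁻¹ * when (does (b ≟F a) ∧ does (p ≟F b′)) (Path p l w)
        + when G (q⁻¹ * ∑ Il (λ s → (LowPath b′ s ⊛ crossing s p l) w)) ∎
      where G = does (b ≟F a) ∧ low b′

    viaFirstExit-∷ : ∀ b l a b′ w → low b ≡ true →
      viaFirstExit b l ((a , b′) ∷ w) ≈
        when (does (b ≟F a)) (q⁻¹ * when (high b′) (ω j b′ * Path b′ l w))
        + when (does (b ≟F a) ∧ low b′) (q⁻¹ * viaFirstExit b′ l w)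
    viaFirstExit-∷ b l a b′ w low-b = begin
      viaFirstExit b l ((a , b′) ∷ w)
        ≈⟨ ∑-cong Ih (λ p → *-congˡ (∑-excursion-∷ b l p a b′ w low-b)) ⟩
      ∑ Ih (λ p → ω j p * (q⁻¹ * when (dba ∧ does (p ≟F b′)) (Path p l w) + when G (q⁻¹ * excursions p)))
        ≈⟨ trans (∑-cong Ih (λ p → distribˡ (ω j p) _ _)) (∑-distrib-+ Ih) ⟩
      ∑ Ih (λ p → ω j p * (q⁻¹ * when (dba ∧ does (p ≟F b′)) (Path p l w)))
        + ∑ Ih (λ p → ω j p * when G (q⁻¹ * excursions p))
        ≈⟨ +-cong (∑-cong Ih (λ p → *-*-when-∧ dba (does (p ≟F b′)) (ω j p) q⁻¹ (Path p l w)))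
                  (∑-cong Ih (λ p → trans (*-when G (ω j p) _) (when-cong G (λ _ → x∙yz≈y∙xz (ω j p) q⁻¹ _)))) ⟩
      ∑ Ih (λ p → when dba (q⁻¹ * when (does (p ≟F b′)) (ω j p * Path p l w)))
        + ∑ Ih (λ p → when G (q⁻¹ * (ω j p * excursions p)))
        ≈⟨ +-cong (trans (∑-when Ih dba _) (when-cong dba (λ _ →
                     trans (sym (*-distribˡ-∑ Ih q⁻¹)) (*-congˡ (∑-filterᵇ-δ high (λ p → ω j p * Path p l w) b′)))))
                  (trans (∑-when Ih G _) (when-cong G (λ _ → sym (*-distribˡ-∑ Ih q⁻¹)))) ⟩
      when dba (q⁻¹ * when (high b′) (ω j b′ * Path b′ l w)) + when G (q⁻¹ * viaFirstExit b′ l w) ∎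
      where
      dba = does (b ≟F a)
      G   = dba ∧ low b′
      excursions : Fin m → Carrier
      excursions p = ∑ Il (λ s → (LowPath b′ s ⊛ crossing s p l) w)

    wt-from-low : ∀ b b′ x → low b ≡ true →
                  wt b b′ * x ≈ q⁻¹ * when (high b′) (ω j b′ * x) + when (low b′) (q⁻¹ * x)
    wt-from-low b b′ x low-b with high-or-low b′
    ... | inj₁ (high-b′ , low-b′) rewrite high-b′ | low-b′ = begin
      (ω j b′ * θ i b) * x        ≈⟨ *-congʳ (*-congˡ (θ≈q⁻¹ b low-b)) ⟩
      (ω j b′ * q⁻¹) * x          ≈⟨ trans (*-congʳ (*-comm _ _)) (*-assoc _ _ _) ⟩
      q⁻¹ * (ω j b′ * x)          ≈⟨ sym (+-identityʳ _) ⟩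
      q⁻¹ * (ω j b′ * x) + 0#     ∎
    ... | inj₂ (high-b′ , low-b′) rewrite high-b′ | low-b′ = begin
      (ω j b′ * θ i b) * x        ≈⟨ *-congʳ (*-cong (ω≈1 b′ low-b′) (θ≈q⁻¹ b low-b)) ⟩
      (1# * q⁻¹) * x              ≈⟨ *-congʳ (*-identityˡ _) ⟩
      q⁻¹ * x                     ≈⟨ sym (trans (+-congʳ (zeroʳ q⁻¹)) (+-identityˡ _)) ⟩
      q⁻¹ * 0# + q⁻¹ * x          ∎

    path≈viaFirstExit : ∀ w b l → low b ≡ true → high l ≡ true → Path b l w ≈ viaFirstExit b l w
    path≈viaFirstExit [] b l low-b high-l = begin
      when (does (b ≟F l)) 1#     ≡⟨ cong (λ d → when d 1#) (low⇒≢high b l low-b high-l) ⟩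
      0#                          ≈⟨ sym (∑-zero Ih (λ p →
                                           trans (*-congˡ (∑-zero Il (λ s → no-excursion s p))) (zeroʳ _))) ⟩
      viaFirstExit b l []         ∎
      where
      no-excursion : ∀ s p → (LowPath b s ⊛ crossing s p l) [] ≈ 0#
      no-excursion s p = trans (⊛-[] (LowPath b s) (crossing s p l)) (trans (*-congˡ (crossing-[] s p l)) (zeroʳ _))
    path≈viaFirstExit ((a , b′) ∷ w) b l low-b high-l = begin
      Path b l ((a , b′) ∷ w)
        ≡⟨ if-∧ dba ⟩
      when dba (wt b b′ * Path b′ l w)
        ≈⟨ when-cong dba (λ _ → trans (wt-from-low b b′ _ low-b) (+-congˡ (when-cong (low b′) (λ low-b′ →
             *-congˡ (path≈viaFirstExit w b′ l low-b′ high-l))))) ⟩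
      when dba (q⁻¹ * when (high b′) (ω j b′ * Path b′ l w) + when (low b′) (q⁻¹ * viaFirstExit b′ l w))
        ≈⟨ sym (when-+ dba _ _) ⟩
      when dba (q⁻¹ * when (high b′) (ω j b′ * Path b′ l w)) + when dba (when (low b′) (q⁻¹ * viaFirstExit b′ l w))
        ≡⟨ cong (when dba (q⁻¹ * when (high b′) (ω j b′ * Path b′ l w)) +_) (≡.sym (if-∧ dba)) ⟩
      when dba (q⁻¹ * when (high b′) (ω j b′ * Path b′ l w)) + when (dba ∧ low b′) (q⁻¹ * viaFirstExit b′ l w)
        ≈⟨ sym (viaFirstExit-∷ b l a b′ w low-b) ⟩
      viaFirstExit b l ((a , b′) ∷ w) ∎
      where dba = does (b ≟F a)

    Y : Mat
    Y = twist i j (Cmat n q⁻¹)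

    detour : Fin m → Fin m → Fin m → PS
    detour r s p = geomM Il (λ x y → q⁻¹ · var x y) r s ⊛ (q⁻¹ · var s p)

    Y₀ : ∀ k l → Y k l [] ≈ 0#
    Y₀ k l = trans (*-congˡ (trans (+-identityˡ _) (trans (reflexive (sumPS-apply Il _ []))
      (∑-zero Il (λ r → trans (reflexive (sumPS-apply Il _ []))
                              (∑-zero Il (λ s → var-⊛-[] k r (detour r s l)))))))) (zeroʳ _)

    Cmat-⊛-∷ : ∀ k p (F : PS) a b w → (Cmat n q⁻¹ k p ⊛ F) ((a , b) ∷ w) ≈
      when (does (k ≟F a)) (when (does (p ≟F b)) (F w) + when (low b) (∑ Il (λ s → (detour b s p ⊛ F) w)))
    Cmat-⊛-∷ k p F a b w = begin
      (Cmat n q⁻¹ k p ⊛ F) ((a , b) ∷ w)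
        ≈⟨ ⊛-distribʳ-⊕ (var k p) _ F ((a , b) ∷ w) ⟩
      (var k p ⊛ F) ((a , b) ∷ w)
        + (sumPS (map (λ r → sumPS (map (λ s → var k r ⊛ detour r s p) Il)) Il) ⊛ F) ((a , b) ∷ w)
        ≈⟨ +-cong (var-⊛-∷ k p F (a , b) w) (trans (sumPS-⊛ Il _ F ((a , b) ∷ w))
             (∑-cong Il (λ r → trans (sumPS-⊛ Il (λ s → var k r ⊛ detour r s p) F ((a , b) ∷ w))
             (∑-cong Il (λ s → trans (⊛-assoc (var k r) (detour r s p) F ((a , b) ∷ w))
                                     (var-⊛-∷ k r (detour r s p ⊛ F) (a , b) w)))))) ⟩
      when (dka ∧ does (p ≟F b)) (F w) + ∑ Il (λ r → ∑ Il (λ s → when (dka ∧ does (r ≟F b)) ((detour r s p ⊛ F) w)))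
        ≈⟨ +-congˡ (∑-cong Il (λ r → trans (∑-when Il (dka ∧ does (r ≟F b)) _) (reflexive (if-∧ dka)))) ⟩
      when (dka ∧ does (p ≟F b)) (F w) + ∑ Il (λ r → when dka (when (does (r ≟F b)) (detours r)))
        ≈⟨ +-cong (reflexive (if-∧ dka)) (trans (∑-when Il dka _) (when-cong dka (λ _ → ∑-filterᵇ-δ low detours b))) ⟩
      when dka (when (does (p ≟F b)) (F w)) + when dka (when (low b) (detours b))
        ≈⟨ when-+ dka _ _ ⟩
      when dka (when (does (p ≟F b)) (F w) + when (low b) (detours b)) ∎
      where
      dka = does (k ≟F a)
      detours : Fin m → Carrier
      detours r = ∑ Il (λ s → (detour r s p ⊛ F) w)

    ∑-Y-⊛-∷ : ∀ k (F : Fin m → PS) a b w →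
      ∑ Ih (λ p → (Y k p ⊛ F p) ((a , b) ∷ w)) ≈
        when (does (k ≟F a)) (when (high b) (wt k b * F b w)
                              + when (low b) (∑ Ih (λ p → wt k p * ∑ Il (λ s → (detour b s p ⊛ F p) w))))
    ∑-Y-⊛-∷ k F a b w = begin
      ∑ Ih (λ p → (Y k p ⊛ F p) ((a , b) ∷ w))
        ≈⟨ ∑-cong Ih (λ p → trans (·-⊛ (wt k p) (Cmat n q⁻¹ k p) (F p) ((a , b) ∷ w))
             (trans (*-congˡ (Cmat-⊛-∷ k p (F p) a b w)) (*-when dka (wt k p) _))) ⟩
      ∑ Ih (λ p → when dka (wt k p * (when (does (p ≟F b)) (F p w) + when (low b) (detours p))))
        ≈⟨ trans (∑-when Ih dka _)
                 (when-cong dka (λ _ → trans (∑-cong Ih (λ p → distribˡ (wt k p) _ _)) (∑-distrib-+ Ih))) ⟩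
      when dka (∑ Ih (λ p → wt k p * when (does (p ≟F b)) (F p w)) + ∑ Ih (λ p → wt k p * when (low b) (detours p)))
        ≈⟨ when-cong dka (λ _ → +-cong
             (trans (∑-cong Ih (λ p → *-when (does (p ≟F b)) (wt k p) _)) (∑-filterᵇ-δ high (λ p → wt k p * F p w) b))
             (trans (∑-cong Ih (λ p → *-when (low b) (wt k p) _)) (∑-when Ih (low b) _))) ⟩
      when dka (when (high b) (wt k b * F b w) + when (low b) (∑ Ih (λ p → wt k p * detours p))) ∎
      where
      dka = does (k ≟F a)
      detours : Fin m → Carrier
      detours p = ∑ Il (λ s → (detour b s p ⊛ F p) w)

    ∑-detour-path : ∀ k b l w → low b ≡ true → high l ≡ true →
      ∑ Ih (λ p → wt k p * ∑ Il (λ s → (detour b s p ⊛ Path p l) w)) ≈ wt k b * Path b l w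
    ∑-detour-path k b l w low-b high-l = begin
      ∑ Ih (λ p → wt k p * ∑ Il (λ s → (detour b s p ⊛ Path p l) w))
        ≈⟨ ∑-cong Ih (λ p → *-congˡ (∑-filterᵇ-cong (allFin m) low (λ s low-s →
             trans (⊛-assoc (geomM Il _ b s) (q⁻¹ · var s p) (Path p l) w)
                   (⊛-congˡ (crossing s p l) (lowGeom≈LowPath b s low-b low-s) w)))) ⟩
      ∑ Ih (λ p → (ω j p * θ i k) * ∑ Il (λ s → (LowPath b s ⊛ crossing s p l) w))
        ≈⟨ ∑-cong Ih (λ p → trans (*-congʳ (*-comm _ _)) (*-assoc _ _ _)) ⟩
      ∑ Ih (λ p → θ i k * (ω j p * ∑ Il (λ s → (LowPath b s ⊛ crossing s p l) w)))
        ≈⟨ sym (*-distribˡ-∑ Ih (θ i k)) ⟩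
      θ i k * viaFirstExit b l w       ≈⟨ *-congˡ (sym (path≈viaFirstExit w b l low-b high-l)) ⟩
      θ i k * Path b l w               ≈⟨ *-congʳ (sym (trans (*-congʳ (ω≈1 b low-b)) (*-identityˡ _))) ⟩
      (ω j b * θ i k) * Path b l w     ∎
      where open WeightedLetters low (λ _ _ → q⁻¹) using () renaming (geomM≈pathSeries to lowGeom≈LowPath)

    open Geometric high Y Y₀ using (SolvesGeom)

    path-solves : SolvesGeom Path
    path-solves k l high-k high-l [] = sym (begin
      idM k l [] + ∑ Ih (λ p → (Y k p ⊛ Path p l) [])
        ≈⟨ +-congˡ (∑-zero Ih (λ p → trans (⊛-[] (Y k p) (Path p l)) (trans (*-congʳ (Y₀ k p)) (zeroˡ _)))) ⟩
      idM k l [] + 0#          ≈⟨ +-identityʳ _ ⟩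
      idM k l []               ≡⟨ idM-[] k l ⟩
      Path k l []              ∎)
    path-solves k l high-k high-l ((a , b) ∷ w) = begin
      Path k l ((a , b) ∷ w)
        ≡⟨ if-∧ dka ⟩
      when dka (wt k b * Path b l w)
        ≈⟨ when-cong dka (λ _ → split-at-b) ⟩
      when dka (when (high b) (wt k b * Path b l w)
                + when (low b) (∑ Ih (λ p → wt k p * ∑ Il (λ s → (detour b s p ⊛ Path p l) w))))
        ≈⟨ sym (∑-Y-⊛-∷ k (λ p → Path p l) a b w) ⟩
      ∑ Ih (λ p → (Y k p ⊛ Path p l) ((a , b) ∷ w))
        ≈⟨ sym (trans (+-congʳ (idM-∷ k l (a , b) w)) (+-identityˡ _)) ⟩
      idM k l ((a , b) ∷ w) + ∑ Ih (λ p → (Y k p ⊛ Path p l) ((a , b) ∷ w)) ∎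
      where
      dka = does (k ≟F a)
      split-at-b : wt k b * Path b l w ≈ when (high b) (wt k b * Path b l w)
                     + when (low b) (∑ Ih (λ p → wt k p * ∑ Il (λ s → (detour b s p ⊛ Path p l) w)))
      split-at-b with high-or-low b
      ... | inj₁ (high-b , low-b) rewrite high-b | low-b = sym (+-identityʳ _)
      ... | inj₂ (high-b , low-b) rewrite high-b | low-b =
        sym (trans (+-identityˡ _) (∑-detour-path k b l w low-b high-l))

    geomM-twist-A≈geomM-twist-C : ∀ i′ j′ → n ≤ toℕ i′ → n ≤ toℕ j′ →
      geomM fullIdx (twist i j Avar) i′ j′ ≋ geomM (highIdx n) (twist i j (Cmat n q⁻¹)) i′ j′
    geomM-twist-A≈geomM-twist-C i′ j′ n≤i′ n≤j′ w = begin
      geomM fullIdx (twist i j Avar) i′ j′ w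
        ≡⟨ cong (λ I → geomM I (twist i j Avar) i′ j′ w) (≡.sym (filterᵇ-accept-all (allFin m))) ⟩
      geomM (filterᵇ (λ _ → true) (allFin m)) (twist i j Avar) i′ j′ w
        ≈⟨ geomM≈pathSeries i′ j′ ≡.refl ≡.refl w ⟩
      Path i′ j′ w
        ≈⟨ sym (geomM-unique Path path-solves i′ j′ (≤⇒≤ᵇ≡true n≤i′) (≤⇒≤ᵇ≡true n≤j′) w) ⟩
      geomM (highIdx n) (twist i j (Cmat n q⁻¹)) i′ j′ w ∎
      where
      open WeightedLetters (λ _ → true) wt using (geomM≈pathSeries)
      open Geometric high Y Y₀ using (geomM-unique)

proposition9p2 : ∀ {c ℓ} (R : CommutativeRing c ℓ) (m n : ℕ) → 1 ≤ n → n < m →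
  let open CommutativeRing R in
  let open Series R m in
  (q qinv : Fin m → Fin m → Carrier) (qq qqinv : Carrier) →
  (∀ (k l : Fin m) → toℕ k < toℕ l → q k l * qinv k l ≈ 1#) →
  qq * qqinv ≈ 1# →
  (∀ (k l : Fin m) → toℕ k < n → n ≤ toℕ l → q k l ≈ qq) →
  (i j : Fin m) → n ≤ toℕ i → n ≤ toℕ j →
  (i' j' : Fin m) → n ≤ toℕ i' → n ≤ toℕ j' →
  geomM fullIdx (Twist.twist q qinv i j Avar) i' j'
    ≋ geomM (highIdx n) (Twist.twist q qinv i j (Cmat n qqinv)) i' j'
-- The bounds 1 ≤ n < m only exclude degenerate cases in which the identity holds as well.
proposition9p2 R m n _ _ q qinv qq qqinv q-inv qq-inv q-cross i j n≤i n≤j =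
  SchurComplement.geomM-twist-A≈geomM-twist-C n q qinv qqinv i j
    (ω-below q qinv j n≤j) (θ-below q qinv qq qqinv q-inv qq-inv q-cross i n≤i)
  where open SeriesAlgebra R m
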